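{- Let $q$ be a power of an odd prime and $E\subseteq\mathbb{F}_q^2$. For $\theta\in O(\mathbb{F}_q^2)$ and $w\in\mathbb{F}_q^2$ let $\lambda_\theta(w)=|\{(u,v)\in E^2: u-\theta v=w\}|$, and for nonnegative integers $a,b$ let $$\Psi(a,b)=\sum_{x,x'\in\mathbb{F}_q^2}\sum_{\theta,\phi\in O(\mathbb{F}_q^2)}\lambda_\theta(x-\theta x')^a\,\lambda_\phi(x-\phi x')^b.$$ Then $\Psi(2,2)\le\Psi(3,1)$.
   Context: $O(\mathbb{F}_q^2)$ denotes the orthogonal group of $2\times 2$ matrices $\theta$ over $\mathbb{F}_q$ with $\theta^T\theta=I$ (preserving $\|x\|=x_1^2+x_2^2$). -}

module Defs where

open import Level using (0ℓ)
open import Algebra.Bundles using (CommutativeRing)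
open import Data.Bool using (Bool; true; false; _∧_; if_then_else_)
open import Data.Nat using (ℕ; _^_) renaming (_+_ to _+ℕ_; _*_ to _*ℕ_)
open import Data.List using (List; []; _∷_; map; concatMap; length; filter)
open import Data.Nat.ListAction using (sum)
open import Data.Bool.Properties using (T?)
open import Data.List.Relation.Unary.Any using (Any)
open import Data.List.Relation.Unary.AllPairs using (AllPairs)
open import Data.Product using (_×_; _,_; Σ)
open import Relation.Nullary using (¬_; Dec; yes; no)
open import Relation.Nullary.Decidable using (⌊_⌋)
open import Relation.Binary using (Decidable)

record FiniteField : Set₁ where
  field
    commRing  : CommutativeRing 0ℓ 0ℓ
  open CommutativeRing commRing public hiding (ring)
  field
    1≉0       : ¬ (1# ≈ 0#)
    inverse   : ∀ x → ¬ (x ≈ 0#) → Σ Carrier (λ y → (x * y) ≈ 1#)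
    _≟_       : Decidable _≈_
    elems     : List Carrier
    complete  : ∀ x → Any (x ≈_) elems
    distinct  : AllPairs (λ x y → ¬ (x ≈ y)) elems

-- Odd characteristic, i.e. q is a power of an odd prime.
OddChar : FiniteField → Set
OddChar F = ¬ ((1# + 1#) ≈ 0#) where open FiniteField F

count : {A : Set} → (A → Bool) → List A → ℕ
count p xs = length (filter (λ x → T? (p x)) xs)

cartesian : {A B : Set} → List A → List B → List (A × B)
cartesian xs ys = concatMap (λ x → map (λ y → (x , y)) ys) xs

module _ (F : FiniteField) where
  open FiniteField F

  Vec2 : Set
  Vec2 = Carrier × Carrier

  elemsV : List Vec2
  elemsV = cartesian elems elems

  _-V_ : Vec2 → Vec2 → Vec2
  (x₁ , x₂) -V (y₁ , y₂) = (x₁ + (- y₁)) , (x₂ + (- y₂))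

  eqV : Vec2 → Vec2 → Bool
  eqV (x₁ , x₂) (y₁ , y₂) = ⌊ x₁ ≟ y₁ ⌋ ∧ ⌊ x₂ ≟ y₂ ⌋

  -- 2×2 matrices ((a , b) , (c , d)) = [[a, b], [c, d]] (rows)
  Mat2 : Set
  Mat2 = Vec2 × Vec2

  _·_ : Mat2 → Vec2 → Vec2
  ((a , b) , (c , d)) · (v₁ , v₂) = ((a * v₁) + (b * v₂)) , ((c * v₁) + (d * v₂))

  isOrthogonal : Mat2 → Bool
  isOrthogonal ((a , b) , (c , d)) =
    ⌊ ((a * a) + (c * c)) ≟ 1# ⌋ ∧ ⌊ ((a * b) + (c * d)) ≟ 0# ⌋
    ∧ ⌊ ((b * a) + (d * c)) ≟ 0# ⌋ ∧ ⌊ ((b * b) + (d * d)) ≟ 1# ⌋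

  O2 : List Mat2
  O2 = filter (λ m → T? (isOrthogonal m)) (cartesian elemsV elemsV)

  module _ (E : Vec2 → Bool) where

    lam : Mat2 → Vec2 → ℕ
    lam θ w = count (λ { (u , v) → E u ∧ E v ∧ eqV (u -V (θ · v)) w })
                    (cartesian elemsV elemsV)

    Ψ : ℕ → ℕ → ℕ
    Ψ a b = sum (map (λ { (x , x') →
              sum (map (λ { (θ , φ) →
                 (lam θ (x -V (θ · x')) ^ a) *ℕ (lam φ (x -V (φ · x')) ^ b) })
                (cartesian O2 O2)) })
            (cartesian elemsV elemsV))

{-# OPTIONS --safe #-}
module Submission where

-- For fixed x, x' write g θ = λ_θ(x − θx'). The (θ, φ)-sum then factors:
-- it is (Σ g²)² in Ψ(2,2) and Σ g³ · Σ g in Ψ(3,1), so the claim is the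
-- moment inequality (Σ g²)² ≤ Σ g³ · Σ g, pointwise in (x, x'). Summing the
-- pairwise bound 2 a²b² ≤ a b³ + a³ b (that is, ab(a − b)² ≥ 0) over all
-- pairs gives 2 (Σ g²)² ≤ Σ g · Σ g³ + Σ g³ · Σ g. Nothing about F, E or the
-- orthogonal group is used.

open import Defs
open import Data.Bool using (Bool)
open import Data.Nat using (ℕ; _+_; _*_; _^_; _∸_; _≤_)
open import Data.Nat.Properties
open import Data.Nat.Solver using (module +-*-Solver)
open import Data.Nat.ListAction using (sum)
open import Data.Nat.ListAction.Properties using (sum-++)
open import Data.List using (List; []; _∷_; _++_; map)
open import Data.List.Properties using (map-++; map-∘; map-cong)
open import Data.Product using (_×_; _,_)
open import Algebra.Properties.CommutativeSemigroup +-commutativeSemigroup using (interchange)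
open import Relation.Binary.Consequences using (wlog)
open import Relation.Binary.PropositionalEquality

open +-*-Solver using (solve; _:+_; _:*_; _:^_; _:=_; con)

private
  variable
    A B : Set

sum-map-++ : (f : A → ℕ) (xs ys : List A) →
             sum (map f (xs ++ ys)) ≡ sum (map f xs) + sum (map f ys)
sum-map-++ f xs ys = trans (cong sum (map-++ f xs ys)) (sum-++ (map f xs) (map f ys))

sum-map-+ : (f g : A → ℕ) (xs : List A) →
            sum (map (λ x → f x + g x) xs) ≡ sum (map f xs) + sum (map g xs)
sum-map-+ f g []       = refl
sum-map-+ f g (x ∷ xs) =
  trans (cong (f x + g x +_) (sum-map-+ f g xs)) (interchange (f x) (g x) _ _)

sum-map-*ˡ : (c : ℕ) (f : A → ℕ) (xs : List A) →
             sum (map (λ x → c * f x) xs) ≡ c * sum (map f xs)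
sum-map-*ˡ c f []       = sym (*-zeroʳ c)
sum-map-*ˡ c f (x ∷ xs) =
  trans (cong (c * f x +_) (sum-map-*ˡ c f xs)) (sym (*-distribˡ-+ c (f x) _))

sum-map-*ʳ : (c : ℕ) (f : A → ℕ) (xs : List A) →
             sum (map (λ x → f x * c) xs) ≡ sum (map f xs) * c
sum-map-*ʳ c f []       = refl
sum-map-*ʳ c f (x ∷ xs) =
  trans (cong (f x * c +_) (sum-map-*ʳ c f xs)) (sym (*-distribʳ-+ c (f x) _))

sum-map-mono-≤ : {f g : A → ℕ} → (∀ x → f x ≤ g x) →
                 (xs : List A) → sum (map f xs) ≤ sum (map g xs)
sum-map-mono-≤ f≤g []       = ≤-refl
sum-map-mono-≤ f≤g (x ∷ xs) = +-mono-≤ (f≤g x) (sum-map-mono-≤ f≤g xs)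

sum-map-cartesian : (f : A × B → ℕ) (xs : List A) (ys : List B) →
                    sum (map f (cartesian xs ys)) ≡
                    sum (map (λ x → sum (map (λ y → f (x , y)) ys)) xs)
sum-map-cartesian f []       ys = refl
sum-map-cartesian f (x ∷ xs) ys =
  trans (sum-map-++ f (map (x ,_) ys) (cartesian xs ys))
        (cong₂ _+_ (cong sum (sym (map-∘ ys))) (sum-map-cartesian f xs ys))

sum-map-cartesian-* : (f : A → ℕ) (h : B → ℕ) (xs : List A) (ys : List B) →
                      sum (map (λ (x , y) → f x * h y) (cartesian xs ys)) ≡
                      sum (map f xs) * sum (map h ys)
sum-map-cartesian-* f h xs ys = begin
  sum (map (λ (x , y) → f x * h y) (cartesian xs ys))
    ≡⟨ sum-map-cartesian (λ (x , y) → f x * h y) xs ys ⟩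
  sum (map (λ x → sum (map (λ y → f x * h y) ys)) xs)
    ≡⟨ cong sum (map-cong (λ x → sum-map-*ˡ (f x) h ys) xs) ⟩
  sum (map (λ x → f x * sum (map h ys)) xs)
    ≡⟨ sum-map-*ʳ (sum (map h ys)) f xs ⟩
  sum (map f xs) * sum (map h ys) ∎
  where open ≡-Reasoning

2mn≤m²+n² : ∀ m n → 2 * (m * n) ≤ m ^ 2 + n ^ 2
2mn≤m²+n² = wlog {Q = Bound} ≤-total (λ {m n} → symmetric m n) ordered
  where
  Bound : ℕ → ℕ → Set
  Bound m n = 2 * (m * n) ≤ m ^ 2 + n ^ 2

  symmetric : ∀ m n → Bound m n → Bound n m
  symmetric m n = subst₂ _≤_ (cong (2 *_) (*-comm m n)) (+-comm (m ^ 2) (n ^ 2))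

  expand : ∀ m d → m ^ 2 + (m + d) ^ 2 ≡ 2 * (m * (m + d)) + d ^ 2
  expand = solve 2 (λ m d → m :^ 2 :+ (m :+ d) :^ 2 := con 2 :* (m :* (m :+ d)) :+ d :^ 2) refl

  gap : ∀ m d → Bound m (m + d)
  gap m d = subst (2 * (m * (m + d)) ≤_) (sym (expand m d)) (m≤m+n _ (d ^ 2))

  ordered : ∀ m n → m ≤ n → Bound m n
  ordered m n m≤n = subst (Bound m) (m+[n∸m]≡n m≤n) (gap m (n ∸ m))

m²n²+m²n²≤mn³+m³n : ∀ m n → m ^ 2 * n ^ 2 + m ^ 2 * n ^ 2 ≤ m ^ 1 * n ^ 3 + m ^ 3 * n ^ 1
m²n²+m²n²≤mn³+m³n m n = begin
  m ^ 2 * n ^ 2 + m ^ 2 * n ^ 2   ≡⟨ solve 2 (λ m n → m :^ 2 :* n :^ 2 :+ m :^ 2 :* n :^ 2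
                                                  := (m :* n) :* (con 2 :* (m :* n))) refl m n ⟩
  (m * n) * (2 * (m * n))         ≤⟨ *-monoʳ-≤ (m * n) (2mn≤m²+n² m n) ⟩
  (m * n) * (m ^ 2 + n ^ 2)       ≡⟨ solve 2 (λ m n → (m :* n) :* (m :^ 2 :+ n :^ 2)
                                                  := m :^ 1 :* n :^ 3 :+ m :^ 3 :* n :^ 1) refl m n ⟩
  m ^ 1 * n ^ 3 + m ^ 3 * n ^ 1   ∎
  where open ≤-Reasoning

sum²²≤sum³¹ : {A : Set} (g : A → ℕ) (xs : List A) →
              sum (map (λ (x , y) → g x ^ 2 * g y ^ 2) (cartesian xs xs)) ≤
              sum (map (λ (x , y) → g x ^ 3 * g y ^ 1) (cartesian xs xs))
sum²²≤sum³¹ {A} g xs = *-cancelˡ-≤ 2 (begin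
  2 * L                                   ≡⟨ double L ⟩
  L + L                                   ≡⟨ sum-map-+ f₂₂ f₂₂ pairs ⟨
  sum (map (λ p → f₂₂ p + f₂₂ p) pairs)   ≤⟨ sum-map-mono-≤ pairwise pairs ⟩
  sum (map (λ p → f₁₃ p + f₃₁ p) pairs)   ≡⟨ sum-map-+ f₁₃ f₃₁ pairs ⟩
  sum (map f₁₃ pairs) + R                 ≡⟨ cong (_+ R) swap ⟩
  R + R                                   ≡⟨ double R ⟨
  2 * R                                   ∎)
  where
  open ≤-Reasoning

  pairs : List (A × A)
  pairs = cartesian xs xs

  f₂₂ f₁₃ f₃₁ : A × A → ℕ
  f₂₂ (x , y) = g x ^ 2 * g y ^ 2
  f₁₃ (x , y) = g x ^ 1 * g y ^ 3
  f₃₁ (x , y) = g x ^ 3 * g y ^ 1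

  L R : ℕ
  L = sum (map f₂₂ pairs)
  R = sum (map f₃₁ pairs)

  pairwise : ∀ p → f₂₂ p + f₂₂ p ≤ f₁₃ p + f₃₁ p
  pairwise (x , y) = m²n²+m²n²≤mn³+m³n (g x) (g y)

  double : ∀ m → 2 * m ≡ m + m
  double m = cong (m +_) (+-identityʳ m)

  moment : ℕ → ℕ
  moment k = sum (map (λ x → g x ^ k) xs)

  swap : sum (map f₁₃ pairs) ≡ R
  swap = begin-equality
    sum (map f₁₃ pairs)    ≡⟨ sum-map-cartesian-* (λ x → g x ^ 1) (λ y → g y ^ 3) xs xs ⟩
    moment 1 * moment 3    ≡⟨ *-comm (moment 1) (moment 3) ⟩
    moment 3 * moment 1    ≡⟨ sum-map-cartesian-* (λ x → g x ^ 3) (λ y → g y ^ 1) xs xs ⟨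
    R                      ∎

lemma3p4 : (F : FiniteField) → OddChar F → (E : Vec2 F → Bool) →
           Ψ F E 2 2 ≤ Ψ F E 3 1
lemma3p4 F _ E = sum-map-mono-≤
  (λ (x , x') → sum²²≤sum³¹ (λ θ → lam F E θ (_-V_ F x (_·_ F θ x'))) (O2 F))
  (cartesian (elemsV F) (elemsV F))
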